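{- Let $W$ be a set, $\stackrel{\Diamond}{\to}$ a transitive relation on $W$ and $\stackrel{L}{\to}$ an equivalence relation on $W$ such that left commutativity holds. (1) The induced relation $\stackrel{\Diamond}{\to}^{\stackrel{L}{\to}}$ on $W_{\stackrel{L}{\to}}$ is transitive. (2) If $\stackrel{\Diamond}{\to}$ is a preorder, then $\stackrel{\Diamond}{\to}^{\stackrel{L}{\to}}$ is a preorder.
   Context: $W_{\stackrel{L}{\to}}$ is the set of $\stackrel{L}{\to}$-equivalence classes. The induced relation is defined by $C\stackrel{\Diamond}{\to}^{\stackrel{L}{\to}}D$ iff there exist $w\in C$, $v\in D$ with $w\stackrel{\Diamond}{\to}v$. Left commutativity: for all $w,u,u'$, if $w\stackrel{\Diamond}{\to}u$ and $u\stackrel{L}{\to}u'$ then there is $w'$ with $w\stackrel{L}{\to}w'$ and $w'\stackrel{\Diamond}{\to}u'$. A preorder is a reflexive transitive relation. -}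

module Defs where

open import Level using (Level; _⊔_; suc)
open import Data.Product using (Σ; ∃; _×_; _,_)
open import Function.Bundles using (_⇔_)
open import Relation.Binary.Core using (Rel)
open import Relation.Binary.Definitions using (Reflexive; Transitive)

LeftCommutative : ∀ {a ℓ₁ ℓ₂} {W : Set a} → Rel W ℓ₁ → Rel W ℓ₂ → Set (a ⊔ ℓ₁ ⊔ ℓ₂)
LeftCommutative {W = W} _◇_ _L_ =
  ∀ {w u u'} → w ◇ u → u L u' → Σ W λ w' → (w L w') × (w' ◇ u')

record EqClass {a ℓ} {W : Set a} (_L_ : Rel W ℓ) : Set (a ⊔ suc ℓ) where
  field
    member : W → Set ℓ
    rep    : W
    isClass : ∀ x → member x ⇔ (rep L x)
open EqClass public

Induced : ∀ {a ℓ₁ ℓ₂} {W : Set a} (_◇_ : Rel W ℓ₁) (_L_ : Rel W ℓ₂) →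
          Rel (EqClass _L_) (a ⊔ ℓ₁ ⊔ ℓ₂)
Induced {W = W} _◇_ _L_ C D =
  Σ W λ w → Σ W λ v → member C w × member D v × (w ◇ v)

IsPreorderRel : ∀ {a ℓ} {A : Set a} → Rel A ℓ → Set (a ⊔ ℓ)
IsPreorderRel R = Reflexive R × Transitive R

module Submission where

-- Suppose C ◇^L D is witnessed by w ∈ C, v ∈ D with w ◇ v, and D ◇^L E
-- by v' ∈ D, u ∈ E with v' ◇ u. Since v and v' lie in the same class, v L v',
-- so left commutativity moves the first step along L: there is w' with w L w'
-- and w' ◇ v'. Then w' ∈ C (classes are closed under L) and transitivity of ◇
-- gives w' ◇ u, witnessing C ◇^L E. Reflexivity transfers even more directly:
-- the representative of C lies in C, and rep C ◇ rep C.

open import Defs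
open import Data.Product using (_×_; _,_)
open import Function.Bundles using (Equivalence)
open import Relation.Binary.Core using (Rel)
open import Relation.Binary.Definitions using (Reflexive; Transitive)
open import Relation.Binary.Structures using (IsEquivalence)

module Classes {a ℓ} {W : Set a} {_L_ : Rel W ℓ} (isEq : IsEquivalence _L_) where
  open IsEquivalence isEq

  members-related : (C : EqClass _L_) → ∀ {x y} → member C x → member C y → x L y
  members-related C {x} {y} x∈C y∈C =
    trans (sym (Equivalence.to (isClass C x) x∈C)) (Equivalence.to (isClass C y) y∈C)

  member-closed : (C : EqClass _L_) → ∀ {x y} → member C x → x L y → member C y
  member-closed C {x} {y} x∈C xLy =
    Equivalence.from (isClass C y) (trans (Equivalence.to (isClass C x) x∈C) xLy)

  rep-member : (C : EqClass _L_) → member C (rep C)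
  rep-member C = Equivalence.from (isClass C (rep C)) refl

module Induced-properties {a ℓ₁ ℓ₂} {W : Set a} (_◇_ : Rel W ℓ₁) {_L_ : Rel W ℓ₂}
                          (isEq : IsEquivalence _L_) where
  open Classes isEq

  induced-transitive : Transitive _◇_ → LeftCommutative _◇_ _L_ →
                       Transitive (Induced _◇_ _L_)
  induced-transitive ◇-trans leftComm {C} {D} {E}
    (w , v , w∈C , v∈D , w◇v) (v' , u , v'∈D , u∈E , v'◇u)
    with leftComm w◇v (members-related D v∈D v'∈D)
  ... | w' , wLw' , w'◇v' =
    w' , u , member-closed C w∈C wLw' , u∈E , ◇-trans w'◇v' v'◇u

  induced-reflexive : Reflexive _◇_ → Reflexive (Induced _◇_ _L_)
  induced-reflexive ◇-refl {C} = rep C , rep C , rep-member C , rep-member C , ◇-refl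

corollary4p4 : ∀ {a ℓ₁ ℓ₂} {W : Set a} (_◇_ : Rel W ℓ₁) (_L_ : Rel W ℓ₂) →
    Transitive _◇_ → IsEquivalence _L_ → LeftCommutative _◇_ _L_ →
    Transitive (Induced _◇_ _L_) × (IsPreorderRel _◇_ → IsPreorderRel (Induced _◇_ _L_))
-- The implicit class arguments of Transitive/Reflexive are passed explicitly
-- so that they are not instantiated too early.
corollary4p4 _◇_ _L_ ◇-trans isEq leftComm =
  (λ {C} {D} {E} → induced-trans {C} {D} {E}) ,
  λ { (◇-refl , _) → (λ {C} → induced-reflexive ◇-refl {C}) ,
                     (λ {C} {D} {E} → induced-trans {C} {D} {E}) }
  where
  open Induced-properties _◇_ isEq
  induced-trans : Transitive (Induced _◇_ _L_)
  induced-trans {C} {D} {E} = induced-transitive ◇-trans leftComm {C} {D} {E}
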